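{- There is no algorithm in the read/write streams model that uses only one stream, $\log^{O(1)} n$ bits of internal memory and $\log^{O(1)} n$ passes and that, on every input string $s$ of length $n$, outputs a context-free grammar $\mathsf{APPROX}$ generating $s$ and only $s$ with $|\mathsf{APPROX}|\le|\mathsf{OPT}|^{O(1)}$, where $\mathsf{OPT}$ is a smallest grammar generating $s$ and only $s$.
   Context: Read/write streams model: an algorithm has an internal memory of $m$ bits and access to a fixed number of streams (tapes); each stream is a sequence of cells accessed sequentially by a read/write head; a pass is one sequential sweep over a stream. The input string $s$ of length $n$ is initially on the first stream. Grammar sizes are measured in bits. -}

module Defs where

open import Data.Nat using (ℕ; zero; suc; _+_; _*_; _^_; _≤_; _<_)
open import Data.Nat.Logarithm using (⌊log₂_⌋; ⌈log₂_⌉)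
open import Data.Bool using (Bool; true; false)
open import Data.Fin using (Fin; toℕ)
open import Data.List using (List; []; _∷_; _++_; length; replicate; concatMap; lookup)
open import Data.List.Membership.Propositional using (_∈_)
open import Data.Maybe using (Maybe; just; nothing)
open import Data.Product using (Σ; _×_; _,_; proj₁; proj₂)
open import Data.Sum using (_⊎_; inj₁; inj₂)
open import Relation.Binary.PropositionalEquality using (_≡_)

-- Context-free grammars over the binary alphabet Bool.
-- Nonterminals are Fin (suc k); the start symbol is zero.

record Grammar : Set where
  field
    k     : ℕ
    rules : List (Fin (suc k) × List (Fin (suc k) ⊎ Bool))
open Grammar public

mutual
  data Derives (G : Grammar) : Fin (suc (k G)) → List Bool → Set where
    rule : ∀ {A rhs w} → (A , rhs) ∈ rules G → DerivesSeq G rhs w → Derives G A w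

  data DerivesSeq (G : Grammar) : List (Fin (suc (k G)) ⊎ Bool) → List Bool → Set where
    done : DerivesSeq G [] []
    term : ∀ {b xs w} → DerivesSeq G xs w → DerivesSeq G (inj₂ b ∷ xs) (b ∷ w)
    nt   : ∀ {A xs u v} → Derives G A u → DerivesSeq G xs v →
           DerivesSeq G (inj₁ A ∷ xs) (u ++ v)

GeneratesExactly : Grammar → List Bool → Set
GeneratesExactly G s =
  Derives G Data.Fin.zero s × (∀ w → Derives G Data.Fin.zero w → w ≡ s)

-- Width wd = ⌈log₂ (k+4)⌉ bits per symbol code: code 0 = end of rule,
-- 1/2 = terminals false/true, 3+i = nonterminal i.
-- enc G = 1^wd 0 , then for each rule: code(lhs) code(rhs_1) ... code(rhs_l) code(0).

toBits : ℕ → ℕ → List Bool     -- fixed width w, least significant bit first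
toBits zero    n = []
toBits (suc w) n = Data.Nat._≡ᵇ_ (n Data.Nat.% 2) 1 ∷ toBits w (n Data.Nat./ 2)

width : Grammar → ℕ
width G = ⌈log₂ (k G + 4) ⌉

symCode : ∀ {G : Grammar} → Fin (suc (k G)) ⊎ Bool → ℕ
symCode (inj₂ false) = 1
symCode (inj₂ true)  = 2
symCode (inj₁ A)     = 3 + toℕ A

encode : Grammar → List Bool
encode G = replicate (width G) true ++ (false ∷ concatMap encRule (rules G))
  where
  wd = width G
  encRule : Fin (suc (k G)) × List (Fin (suc (k G)) ⊎ Bool) → List Bool
  encRule (A , rhs) =
    toBits wd (3 + toℕ A) ++ concatMap (λ x → toBits wd (symCode {G} x)) rhs ++ toBits wd 0

size : Grammar → ℕ
size G = length (encode G)

-- Read/write streams model with ONE stream (non-uniform: one machine per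
-- input length).  Internal memory of `mem` bits = state space Fin (2 ^ mem).
-- Stream cells hold Maybe Bool (nothing = blank).  Passes are counted as
-- (number of head reversals) + 1.

Cell : Set
Cell = Maybe Bool

data Move : Set where
  left right stay : Move

data Dir : Set where
  ←d →d : Dir

record Machine : Set where
  field
    mem  : ℕ
    init : Fin (2 ^ mem)
    -- nothing = halt
    δ    : Fin (2 ^ mem) → Cell → Maybe (Fin (2 ^ mem) × Cell × Move)
open Machine public

record Config (M : Machine) : Set where
  constructor cfg
  field
    state : Fin (2 ^ mem M)
    tape  : ℕ → Cell
    pos   : ℕ
    dir   : Dir
    revs  : ℕ
open Config public

listTape : List Bool → ℕ → Cell
listTape []       _       = nothing
listTape (b ∷ s)  zero    = just b
listTape (b ∷ s)  (suc i) = listTape s i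

initConfig : (M : Machine) → List Bool → Config M
initConfig M s = cfg (init M) (listTape s) 0 →d 0

write : (ℕ → Cell) → ℕ → Cell → ℕ → Cell
write t p x i with Data.Nat._≡ᵇ_ i p
... | true  = x
... | false = t i

moveHead : ∀ {M} → Config M → Move → Config M
moveHead c stay  = c
moveHead (cfg q t p →d r) left  = cfg q t (Data.Nat.pred p) ←d (suc r)
moveHead (cfg q t p ←d r) left  = cfg q t (Data.Nat.pred p) ←d r
moveHead (cfg q t p →d r) right = cfg q t (suc p) →d r
moveHead (cfg q t p ←d r) right = cfg q t (suc p) →d (suc r)

step : ∀ {M} → Config M → Config M
step {M} c with δ M (state c) (tape c (pos c))
... | nothing = c
... | just (q' , x , mv) =
  moveHead (cfg q' (write (tape c) (pos c) x) (pos c) (dir c) (revs c)) mv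

run : ∀ {M} → ℕ → Config M → Config M
run zero    c = c
run (suc t) c = run t (step c)

Halted : ∀ {M} → Config M → Set
Halted {M} c = δ M (state c) (tape c (pos c)) ≡ nothing

passes : ∀ {M} → Config M → ℕ
passes c = suc (revs c)

Output : (ℕ → Cell) → List Bool → Set
Output t w = (∀ (i : Fin (length w)) → t (toℕ i) ≡ just (lookup w i)) × t (length w) ≡ nothing

polylog : ℕ → ℕ → ℕ
polylog c n = c * (⌊log₂ n ⌋ + 1) ^ c

-- M, on input s, halts within at most p passes, leaving on the stream the
-- encoding of a grammar APPROX with L(APPROX) = {s} and
-- |APPROX| ≤ |OPT|^c (i.e. ≤ |G'|^c for every G' with L(G') = {s}).
SolvesApprox : ℕ → Machine → ℕ → List Bool → Set
SolvesApprox c M p s =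
  Σ ℕ λ t → let fin = run t (initConfig M s) in
    Halted fin × passes fin ≤ p ×
    Σ Grammar λ APPROX →
      Output (tape fin) (encode APPROX) × GeneratesExactly APPROX s ×
      (∀ G' → GeneratesExactly G' s → size APPROX ≤ size G' ^ c)

-- A fooling argument with crossing sequences. Run the machine for length
-- n = 2^K + ℓ on all inputs 0^(2^K) y with |y| = ℓ. Repeated doubling gives a
-- grammar for such an input of size polynomial in K and ℓ, so the approximation,
-- of size at most |OPT|^c, is shorter than 2^K and is written inside the common
-- prefix 0^(2^K). The final contents of that prefix are determined by the
-- states in which the head re-enters it from the right; each re-entry costs a
-- head reversal, so with polylog n passes and polylog n bits of memory there are
-- at most 2^(polylog n)^2 < 2^ℓ such sequences. Two inputs sharing one therefore
-- output the same grammar, and as it generates a single word their suffixes y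
-- coincide, contradicting the pigeonhole principle once K is large enough for
-- the polynomial bounds to drop below 2^K.

module Submission where

open import Defs
open import Data.Empty using (⊥; ⊥-elim)
open import Data.Bool using (Bool; true; false; T)
open import Data.Unit using (tt)
open import Data.Fin using (Fin; toℕ; zero; suc; fromℕ; fromℕ<; inject₁)
open import Data.Fin.Properties using (toℕ<n; toℕ-injective; toℕ-fromℕ; toℕ-fromℕ<; toℕ-inject₁; pigeonhole)
open import Data.List using (List; []; _∷_; _++_; length; replicate; map; concatMap; tabulate)
open import Data.List.Properties
  using (∷-injective; ++-assoc; ++-identityʳ; ++-cancelˡ; concatMap-cong; concatMap-map;
         length-++; length-map; length-replicate; length-tabulate)
open import Data.List.Membership.Propositional using (_∈_)
open import Data.List.Membership.Propositional.Properties using (∈-map⁺; ∈-map⁻; ∈-tabulate⁺; ∈-tabulate⁻)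
open import Data.List.Relation.Unary.All using (All; []; _∷_)
open import Data.List.Relation.Unary.Any using (here; there)
open import Data.Maybe using (Maybe; just; nothing)
open import Data.Nat
open import Data.Nat.DivMod using (_/_; _%_; m≡m%n+[m/n]*n; m%n<n; m<n*o⇒m/o<n; [m+kn]%n≡m%n; m<n⇒m%n≡m)
open import Data.Nat.Induction using (<-wellFounded)
open import Data.Nat.Logarithm using (⌊log₂_⌋; ⌈log₂_⌉; ⌊log₂⌋-mono-≤; ⌊log₂[2^n]⌋≡n; ⌈log₂⌉-mono-≤; ⌈log₂2^n⌉≡n)
open import Data.Nat.Logarithm.Core using (⌈log2⌉)
open import Data.Nat.Properties
open import Data.Nat.Tactic.RingSolver using (solve-∀)
open import Data.Product using (Σ; _×_; _,_; proj₁; proj₂)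
import Data.Product as Product
open import Data.Sum using (_⊎_; inj₁; inj₂)
open import Function using (_∘_)
open import Induction.WellFounded using (Acc; acc)
open import Relation.Binary.PropositionalEquality
open import Relation.Nullary using (¬_; yes; no)

n<2^n : ∀ n → n < 2 ^ n
n<2^n zero    = s≤s z≤n
n<2^n (suc n) = begin
  2 + n            ≡⟨ +-comm 1 (suc n) ⟩
  suc n + 1        ≤⟨ +-mono-≤ (n<2^n n) (m^n>0 2 n) ⟩
  2 ^ n + 2 ^ n    ≡⟨ cong (2 ^ n +_) (sym (+-identityʳ (2 ^ n))) ⟩
  2 ^ suc n        ∎
  where open ≤-Reasoning

n≤2^⌈log₂n⌉ : ∀ n → n ≤ 2 ^ ⌈log₂ n ⌉
n≤2^⌈log₂n⌉ n = go n (<-wellFounded n)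
  where
  go : ∀ n (rec : Acc _<_ n) → n ≤ 2 ^ ⌈log2⌉ n rec
  go 0             _        = z≤n
  go 1             _        = s≤s z≤n
  go (suc (suc n)) (acc rs) = begin
    2 + n                      ≤⟨ s≤s (s≤s (≤-trans (≤-reflexive (sym (⌊n/2⌋+⌈n/2⌉≡n n)))
                                                    (+-monoˡ-≤ ⌈ n /2⌉ (⌊n/2⌋≤⌈n/2⌉ n)))) ⟩
    2 + (⌈ n /2⌉ + ⌈ n /2⌉)    ≡⟨ cong suc (sym (+-suc ⌈ n /2⌉ ⌈ n /2⌉)) ⟩
    suc ⌈ n /2⌉ + suc ⌈ n /2⌉  ≤⟨ +-mono-≤ ih (≤-trans ih (≤-reflexive (sym (+-identityʳ _)))) ⟩
    2 ^ ⌈log2⌉ (2 + n) (acc rs) ∎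
    where
    open ≤-Reasoning
    ih : suc ⌈ n /2⌉ ≤ 2 ^ ⌈log2⌉ (suc ⌈ n /2⌉) (rs (⌈n/2⌉<n n))
    ih = go (suc ⌈ n /2⌉) (rs (⌈n/2⌉<n n))

⌈log₂n⌉≤n : ∀ n → ⌈log₂ n ⌉ ≤ n
⌈log₂n⌉≤n n = ≤-trans (⌈log₂⌉-mono-≤ (<⇒≤ (n<2^n n))) (≤-reflexive (⌈log₂2^n⌉≡n n))

++-injective : ∀ {A : Set} (xs xs' : List A) {ys ys'} → length xs ≡ length xs' →
               xs ++ ys ≡ xs' ++ ys' → xs ≡ xs' × ys ≡ ys'
++-injective []       []         _   eq = refl , eq
++-injective (x ∷ xs) (x' ∷ xs') len eq with ∷-injective eq
... | refl , eq′ = Product.map₁ (cong (x ∷_)) (++-injective xs xs' (suc-injective len) eq′)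

length-toBits : ∀ w n → length (toBits w n) ≡ w
length-toBits zero    n = refl
length-toBits (suc w) n = cong suc (length-toBits w (n / 2))

bit-injective : ∀ {a b} → a < 2 → b < 2 → (a ≡ᵇ 1) ≡ (b ≡ᵇ 1) → a ≡ b
bit-injective {0}           {0}           _ _ _ = refl
bit-injective {1}           {1}           _ _ _ = refl
bit-injective {0}           {1}           _ _ ()
bit-injective {1}           {0}           _ _ ()
bit-injective {suc (suc _)} (s≤s (s≤s ())) _ _
bit-injective {_}           {suc (suc _)} _ (s≤s (s≤s ())) _

toBits-injective : ∀ w {a b} → a < 2 ^ w → b < 2 ^ w → toBits w a ≡ toBits w b → a ≡ b
toBits-injective zero    {zero}  {zero}  _        _        _  = refl
toBits-injective zero    {suc _}         (s≤s ()) _        _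
toBits-injective zero    {zero}  {suc _} _        (s≤s ()) _
toBits-injective (suc w) {a}     {b}     a<       b<       eq with ∷-injective eq
... | low , high = begin
  a                  ≡⟨ m≡m%n+[m/n]*n a 2 ⟩
  a % 2 + a / 2 * 2  ≡⟨ cong₂ (λ r q → r + q * 2) (bit-injective (m%n<n a 2) (m%n<n b 2) low)
                                                  (toBits-injective w (half< a<) (half< b<) high) ⟩
  b % 2 + b / 2 * 2  ≡⟨ sym (m≡m%n+[m/n]*n b 2) ⟩
  b                  ∎
  where
  open ≡-Reasoning
  half< : ∀ {x} → x < 2 ^ suc w → x / 2 < 2 ^ w
  half< {x} x< = m<n*o⇒m/o<n {x} (subst (x <_) (*-comm 2 (2 ^ w)) x<)

toBits-++-injective : ∀ w {a b} {r r' : List Bool} → a < 2 ^ w → b < 2 ^ w →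
                      toBits w a ++ r ≡ toBits w b ++ r' → a ≡ b × r ≡ r'
toBits-++-injective w {a} {b} a< b< eq =
  Product.map₁ (toBits-injective w a< b<)
    (++-injective (toBits w a) (toBits w b) (trans (length-toBits w a) (sym (length-toBits w b))) eq)

-- What the encoding of a grammar determines

RuleCode : Set
RuleCode = ℕ × List ℕ

encodeRuleCode : ℕ → RuleCode → List Bool
encodeRuleCode w (a , cs) = toBits w a ++ concatMap (toBits w) cs ++ toBits w 0

ruleCode : ∀ G → Fin (suc (k G)) × List (Fin (suc (k G)) ⊎ Bool) → RuleCode
ruleCode G (A , rhs) = 3 + toℕ A , map (symCode {G}) rhs

-- The encoding forgets k G beyond the width it determines, so a grammar is
-- recovered from its bits only up to this list of rule codes.
ruleCodes : Grammar → List RuleCode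
ruleCodes G = map (ruleCode G) (rules G)

encode≡ : ∀ G → encode G ≡
          replicate (width G) true ++ false ∷ concatMap (encodeRuleCode (width G)) (ruleCodes G)
encode≡ G = cong (λ z → replicate (width G) true ++ false ∷ z)
  (trans (concatMap-cong (λ (A , rhs) → encodeRule A rhs) (rules G))
         (sym (concatMap-map _ (ruleCode G) (rules G))))
  where
  w : ℕ
  w = width G
  encodeRule : ∀ A rhs → toBits w (3 + toℕ A) ++ concatMap (λ x → toBits w (symCode {G} x)) rhs ++ toBits w 0
                         ≡ encodeRuleCode w (ruleCode G (A , rhs))
  encodeRule A rhs = cong (λ z → toBits w (3 + toℕ A) ++ z ++ toBits w 0)
                          (sym (concatMap-map (toBits w) (symCode {G}) rhs))

ValidCode : ℕ → ℕ → Set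
ValidCode w c = 1 ≤ c × c < 2 ^ w

ValidRuleCode : ℕ → RuleCode → Set
ValidRuleCode w (a , cs) = ValidCode w a × All (ValidCode w) cs

unary-prefix-injective : ∀ a b {r r' : List Bool} →
  replicate a true ++ false ∷ r ≡ replicate b true ++ false ∷ r' → a ≡ b × r ≡ r'
unary-prefix-injective zero    zero    refl = refl , refl
unary-prefix-injective (suc a) (suc b) eq   =
  Product.map₁ (cong suc) (unary-prefix-injective a b (proj₂ (∷-injective eq)))

-- The zero code terminates a rule, and valid codes are nonzero.
symbolCodes-injective : ∀ w (cs cs' : List ℕ) {r r' : List Bool} →
  All (ValidCode w) cs → All (ValidCode w) cs' →
  concatMap (toBits w) cs ++ toBits w 0 ++ r ≡ concatMap (toBits w) cs' ++ toBits w 0 ++ r' →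
  cs ≡ cs' × r ≡ r'
symbolCodes-injective w [] [] _ _ eq =
  refl , proj₂ (toBits-++-injective w (m^n>0 2 w) (m^n>0 2 w) eq)
symbolCodes-injective w [] (c ∷ cs') _ ((1≤c , c<) ∷ _) eq
  with () ← <⇒≢ 1≤c (proj₁ (toBits-++-injective w (m^n>0 2 w) c< (trans eq (++-assoc (toBits w c) _ _))))
symbolCodes-injective w (c ∷ cs) [] ((1≤c , c<) ∷ _) _ eq
  with () ← <⇒≢ 1≤c (sym (proj₁ (toBits-++-injective w c< (m^n>0 2 w) (trans (sym (++-assoc (toBits w c) _ _)) eq))))
symbolCodes-injective w (c ∷ cs) (c' ∷ cs') ((_ , c<) ∷ valid) ((_ , c'<) ∷ valid') eq
  with refl , eq′ ← toBits-++-injective w c< c'<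
         (trans (sym (++-assoc (toBits w c) _ _)) (trans eq (++-assoc (toBits w c') _ _)))
  with refl , eq″ ← symbolCodes-injective w cs cs' valid valid' eq′
  = refl , eq″

encodeRuleCode-++ : ∀ w a cs (r : List Bool) →
  encodeRuleCode w (a , cs) ++ r ≡ toBits w a ++ concatMap (toBits w) cs ++ toBits w 0 ++ r
encodeRuleCode-++ w a cs r =
  trans (++-assoc (toBits w a) _ r) (cong (toBits w a ++_) (++-assoc (concatMap (toBits w) cs) _ r))

toBits-++-nonempty : ∀ {w a} {r : List Bool} → ValidCode w a → toBits w a ++ r ≢ []
toBits-++-nonempty {zero}  (s≤s z≤n , s≤s ())
toBits-++-nonempty {suc w} _ ()

ruleCodes-injective : ∀ w (R R' : List RuleCode) →
  All (ValidRuleCode w) R → All (ValidRuleCode w) R' →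
  concatMap (encodeRuleCode w) R ≡ concatMap (encodeRuleCode w) R' → R ≡ R'
ruleCodes-injective w [] [] _ _ _ = refl
ruleCodes-injective w [] ((a , cs) ∷ R') _ ((valid , _) ∷ _) eq =
  ⊥-elim (toBits-++-nonempty {w} valid (sym (trans eq (encodeRuleCode-++ w a cs _))))
ruleCodes-injective w ((a , cs) ∷ R) [] ((valid , _) ∷ _) _ eq =
  ⊥-elim (toBits-++-nonempty {w} valid (trans (sym (encodeRuleCode-++ w a cs _)) eq))
ruleCodes-injective w ((a , cs) ∷ R) ((a' , cs') ∷ R') (((_ , a<) , valid) ∷ rest) (((_ , a'<) , valid') ∷ rest') eq
  with refl , eq′ ← toBits-++-injective w a< a'<
         (trans (sym (encodeRuleCode-++ w a cs _)) (trans eq (encodeRuleCode-++ w a' cs' _)))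
  with refl , eq″ ← symbolCodes-injective w cs cs' valid valid' eq′
  = cong ((a , cs) ∷_) (ruleCodes-injective w R R' rest rest' eq″)

nonterminalCode<2^width : ∀ G (A : Fin (suc (k G))) → 3 + toℕ A < 2 ^ width G
nonterminalCode<2^width G A = begin-strict
  3 + toℕ A    <⟨ +-monoʳ-< 3 (toℕ<n A) ⟩
  4 + k G      ≡⟨ +-comm 4 (k G) ⟩
  k G + 4      ≤⟨ n≤2^⌈log₂n⌉ (k G + 4) ⟩
  2 ^ width G  ∎
  where open ≤-Reasoning

symCode-valid : ∀ G (x : Fin (suc (k G)) ⊎ Bool) → ValidCode (width G) (symCode {G} x)
symCode-valid G (inj₁ A)     = s≤s z≤n , nonterminalCode<2^width G A
symCode-valid G (inj₂ false) = s≤s z≤n , <-trans (s≤s (s≤s z≤n)) (nonterminalCode<2^width G zero)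
symCode-valid G (inj₂ true)  = s≤s z≤n , <-trans (s≤s (s≤s (s≤s z≤n))) (nonterminalCode<2^width G zero)

ruleCodes-valid : ∀ G → All (ValidRuleCode (width G)) (ruleCodes G)
ruleCodes-valid G = allRules (rules G)
  where
  allSymbols : ∀ rhs → All (ValidCode (width G)) (map (symCode {G}) rhs)
  allSymbols []        = []
  allSymbols (x ∷ rhs) = symCode-valid G x ∷ allSymbols rhs
  allRules : ∀ rs → All (ValidRuleCode (width G)) (map (ruleCode G) rs)
  allRules []              = []
  allRules ((A , rhs) ∷ rs) = (symCode-valid G (inj₁ A) , allSymbols rhs) ∷ allRules rs

encode-injective : ∀ G₁ G₂ → encode G₁ ≡ encode G₂ → ruleCodes G₁ ≡ ruleCodes G₂
encode-injective G₁ G₂ eq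
  with width≡ , eq′ ← unary-prefix-injective (width G₁) (width G₂)
                        (trans (sym (encode≡ G₁)) (trans eq (encode≡ G₂)))
  = ruleCodes-injective (width G₁) _ _ (ruleCodes-valid G₁)
      (subst (λ w → All (ValidRuleCode w) (ruleCodes G₂)) (sym width≡) (ruleCodes-valid G₂))
      (trans eq′ (cong (λ w → concatMap (encodeRuleCode w) (ruleCodes G₂)) (sym width≡)))

mutual
  data CodeDerives (R : List RuleCode) : ℕ → List Bool → Set where
    rule : ∀ {a cs w} → (a , cs) ∈ R → CodeDerivesSeq R cs w → CodeDerives R a w

  data CodeDerivesSeq (R : List RuleCode) : List ℕ → List Bool → Set where
    done  : CodeDerivesSeq R [] []
    term₀ : ∀ {cs w} → CodeDerivesSeq R cs w → CodeDerivesSeq R (1 ∷ cs) (false ∷ w)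
    term₁ : ∀ {cs w} → CodeDerivesSeq R cs w → CodeDerivesSeq R (2 ∷ cs) (true ∷ w)
    nt    : ∀ {a cs u v} → CodeDerives R (3 + a) u → CodeDerivesSeq R cs v →
            CodeDerivesSeq R (3 + a ∷ cs) (u ++ v)

mutual
  toCodeDerives : ∀ G {A w} → Derives G A w → CodeDerives (ruleCodes G) (3 + toℕ A) w
  toCodeDerives G (rule r ds) = rule (∈-map⁺ (ruleCode G) r) (toCodeDerivesSeq G ds)

  toCodeDerivesSeq : ∀ G {xs w} → DerivesSeq G xs w → CodeDerivesSeq (ruleCodes G) (map (symCode {G}) xs) w
  toCodeDerivesSeq G done                = done
  toCodeDerivesSeq G (term {false} ds)   = term₀ (toCodeDerivesSeq G ds)
  toCodeDerivesSeq G (term {true} ds)    = term₁ (toCodeDerivesSeq G ds)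
  toCodeDerivesSeq G (nt d ds)           = nt (toCodeDerives G d) (toCodeDerivesSeq G ds)

mutual
  fromCodeDerives : ∀ G A {w} → CodeDerives (ruleCodes G) (3 + toℕ A) w → Derives G A w
  fromCodeDerives G A (rule r ds) with ∈-map⁻ (ruleCode G) r
  ... | (A' , rhs) , r' , eq with cong proj₁ eq | cong proj₂ eq
  ... | lhs≡ | refl with toℕ-injective (suc-injective (suc-injective (suc-injective lhs≡)))
  ... | refl = rule r' (fromCodeDerivesSeq G rhs ds)

  fromCodeDerivesSeq : ∀ G xs {w} → CodeDerivesSeq (ruleCodes G) (map (symCode {G}) xs) w → DerivesSeq G xs w
  fromCodeDerivesSeq G []               done      = done
  fromCodeDerivesSeq G (inj₂ false ∷ xs) (term₀ ds) = term (fromCodeDerivesSeq G xs ds)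
  fromCodeDerivesSeq G (inj₂ true ∷ xs)  (term₁ ds)  = term (fromCodeDerivesSeq G xs ds)
  fromCodeDerivesSeq G (inj₁ A ∷ xs)     (nt d ds)  = nt (fromCodeDerives G A d) (fromCodeDerivesSeq G xs ds)

same-encoding⇒same-word : ∀ G₁ G₂ {s₁ s₂} → encode G₁ ≡ encode G₂ →
  GeneratesExactly G₁ s₁ → GeneratesExactly G₂ s₂ → s₁ ≡ s₂
same-encoding⇒same-word G₁ G₂ eq (d₁ , _) (_ , only₂) =
  only₂ _ (fromCodeDerives G₂ zero (subst (λ R → CodeDerives R 3 _) (encode-injective G₁ G₂ eq) (toCodeDerives G₁ d₁)))

-- Small grammars for 0^(2^K) y

Functional : Grammar → Set
Functional G = ∀ {A rhs rhs'} → (A , rhs) ∈ rules G → (A , rhs') ∈ rules G → rhs ≡ rhs'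

mutual
  functional⇒derives-unique : ∀ {G} → Functional G → ∀ {A w w'} → Derives G A w → Derives G A w' → w ≡ w'
  functional⇒derives-unique fun (rule r ds) (rule r' ds') with fun r r'
  ... | refl = functional⇒derivesSeq-unique fun ds ds'

  functional⇒derivesSeq-unique : ∀ {G} → Functional G → ∀ {xs w w'} → DerivesSeq G xs w → DerivesSeq G xs w' → w ≡ w'
  functional⇒derivesSeq-unique fun done      done        = refl
  functional⇒derivesSeq-unique fun (term ds) (term ds')  = cong (_ ∷_) (functional⇒derivesSeq-unique fun ds ds')
  functional⇒derivesSeq-unique fun (nt d ds) (nt d' ds') =
    cong₂ _++_ (functional⇒derives-unique fun d d') (functional⇒derivesSeq-unique fun ds ds')

length-concatMap-≤ : ∀ {A B : Set} (f : A → List B) {b} (xs : List A) →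
  (∀ {x} → x ∈ xs → length (f x) ≤ b) → length (concatMap f xs) ≤ length xs * b
length-concatMap-≤ f []       _     = z≤n
length-concatMap-≤ f {b} (x ∷ xs) bound = begin
  length (f x ++ concatMap f xs)           ≡⟨ length-++ (f x) ⟩
  length (f x) + length (concatMap f xs)   ≤⟨ +-mono-≤ (bound (here refl)) (length-concatMap-≤ f xs (λ x∈ → bound (there x∈))) ⟩
  b + length xs * b                        ∎
  where open ≤-Reasoning

length-concatMap-toBits : ∀ w cs → length (concatMap (toBits w) cs) ≡ length cs * w
length-concatMap-toBits w []       = refl
length-concatMap-toBits w (c ∷ cs) =
  trans (length-++ (toBits w c)) (cong₂ _+_ (length-toBits w c) (length-concatMap-toBits w cs))

length-encodeRuleCode : ∀ w a cs → length (encodeRuleCode w (a , cs)) ≡ (2 + length cs) * w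
length-encodeRuleCode w a cs = begin
  length (encodeRuleCode w (a , cs))  ≡⟨ length-++ (toBits w a) ⟩
  length (toBits w a) + length (concatMap (toBits w) cs ++ toBits w 0)
    ≡⟨ cong₂ _+_ (length-toBits w a) (length-++ (concatMap (toBits w) cs)) ⟩
  w + (length (concatMap (toBits w) cs) + length (toBits w 0))
    ≡⟨ cong (w +_) (cong₂ _+_ (length-concatMap-toBits w cs) (length-toBits w 0)) ⟩
  w + (length cs * w + w)             ≡⟨ cong (w +_) (+-comm (length cs * w) w) ⟩
  (2 + length cs) * w                 ∎
  where open ≡-Reasoning

size≤ : ∀ G ℓ → (∀ {r} → r ∈ rules G → length (proj₂ r) ≤ ℓ) →
        size G ≤ width G + suc (length (rules G) * ((2 + ℓ) * width G))
size≤ G ℓ short = begin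
  size G
    ≡⟨ cong length (encode≡ G) ⟩
  length (replicate w true ++ false ∷ concatMap (encodeRuleCode w) (ruleCodes G))
    ≡⟨ length-++ (replicate w true) ⟩
  length (replicate w true) + suc (length (concatMap (encodeRuleCode w) (ruleCodes G)))
    ≡⟨ cong₂ (λ a b → a + suc (length b)) (length-replicate w) (concatMap-map (encodeRuleCode w) (ruleCode G) (rules G)) ⟩
  w + suc (length (concatMap (λ r → encodeRuleCode w (ruleCode G r)) (rules G)))
    ≤⟨ +-monoʳ-≤ w (s≤s (length-concatMap-≤ _ (rules G) ruleLength≤)) ⟩
  w + suc (length (rules G) * ((2 + ℓ) * w)) ∎
  where
  open ≤-Reasoning
  w : ℕ
  w = width G
  ruleLength≤ : ∀ {r} → r ∈ rules G → length (encodeRuleCode w (ruleCode G r)) ≤ (2 + ℓ) * w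
  ruleLength≤ {A , rhs} r∈ = begin
    length (encodeRuleCode w (ruleCode G (A , rhs)))  ≡⟨ length-encodeRuleCode w (3 + toℕ A) (map (symCode {G}) rhs) ⟩
    (2 + length (map (symCode {G}) rhs)) * w         ≡⟨ cong (λ l → (2 + l) * w) (length-map (symCode {G}) rhs) ⟩
    (2 + length rhs) * w                             ≤⟨ *-monoˡ-≤ w (+-monoʳ-≤ 2 (short r∈)) ⟩
    (2 + ℓ) * w                                      ∎

replicate-+ : ∀ {A : Set} a b (x : A) → replicate (a + b) x ≡ replicate a x ++ replicate b x
replicate-+ zero    b x = refl
replicate-+ (suc a) b x = cong (x ∷_) (replicate-+ a b x)

doublingSizeBound : ℕ → ℕ → ℕ
doublingSizeBound K ℓ = (5 + K) + suc ((2 + K) * ((4 + ℓ) * (5 + K)))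

-- S → X_K y, X_0 → 0, X_(i+1) → X_i X_i, with X_i numbered 1 + i.
module DoublingGrammar (K : ℕ) (y : List Bool) where

  rhsOf : Fin (2 + K) → List (Fin (2 + K) ⊎ Bool)
  rhsOf zero          = inj₁ (suc (fromℕ K)) ∷ map inj₂ y
  rhsOf (suc zero)    = inj₂ false ∷ []
  rhsOf (suc (suc i)) = inj₁ (suc (inject₁ i)) ∷ inj₁ (suc (inject₁ i)) ∷ []

  ruleAt : Fin (2 + K) → Fin (2 + K) × List (Fin (2 + K) ⊎ Bool)
  ruleAt A = A , rhsOf A

  grammar : Grammar
  grammar = record { k = suc K ; rules = tabulate ruleAt }

  word : List Bool
  word = replicate (2 ^ K) false ++ y

  ruleOf : ∀ A → (A , rhsOf A) ∈ rules grammar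
  ruleOf A = ∈-tabulate⁺ {f = ruleAt} A

  functional : Functional grammar
  functional r r' with ∈-tabulate⁻ {f = ruleAt} r | ∈-tabulate⁻ {f = ruleAt} r'
  ... | _ , refl | _ , refl = refl

  derives-power : ∀ n (i : Fin (suc K)) → toℕ i ≡ n → Derives grammar (suc i) (replicate (2 ^ n) false)
  derives-power zero    zero    _   = rule (ruleOf (suc zero)) (term done)
  derives-power (suc n) (suc i) i≡n =
    subst (Derives grammar (suc (suc i))) (sym doubled)
      (rule (ruleOf (suc (suc i))) (nt half (nt half done)))
    where
    half : Derives grammar (suc (inject₁ i)) (replicate (2 ^ n) false)
    half = derives-power n (inject₁ i) (trans (toℕ-inject₁ i) (suc-injective i≡n))
    a : ℕ
    a = 2 ^ n
    doubled : replicate (a + (a + 0)) false ≡ replicate a false ++ (replicate a false ++ [])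
    doubled = trans (replicate-+ a (a + 0) false)
                    (cong (replicate a false ++_)
                          (trans (cong (λ z → replicate z false) (+-identityʳ a)) (sym (++-identityʳ _))))

  terminals : ∀ ys → DerivesSeq grammar (map inj₂ ys) ys
  terminals []       = done
  terminals (b ∷ ys) = term (terminals ys)

  generates : GeneratesExactly grammar word
  generates = start , λ w d → functional⇒derives-unique functional d start
    where
    start : Derives grammar zero word
    start = rule (ruleOf zero) (nt (derives-power K (fromℕ K) (toℕ-fromℕ K)) (terminals y))

  size-grammar≤ : size grammar ≤ doublingSizeBound K (length y)
  size-grammar≤ = ≤-trans (size≤ grammar (2 + length y) rhs≤)
    (+-mono-≤ width≤ (s≤s (*-mono-≤ (≤-reflexive (length-tabulate ruleAt))
                                     (*-monoʳ-≤ (4 + length y) width≤))))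
    where
    width≤ : width grammar ≤ 5 + K
    width≤ = ≤-trans (⌈log₂n⌉≤n (suc K + 4)) (≤-reflexive (+-comm (suc K) 4))
    rhsLength≤ : ∀ A → length (rhsOf A) ≤ 2 + length y
    rhsLength≤ zero          = s≤s (≤-trans (≤-reflexive (length-map inj₂ y)) (n≤1+n _))
    rhsLength≤ (suc zero)    = s≤s z≤n
    rhsLength≤ (suc (suc i)) = s≤s (s≤s z≤n)
    rhs≤ : ∀ {r} → r ∈ rules grammar → length (proj₂ r) ≤ 2 + length y
    rhs≤ r∈ with ∈-tabulate⁻ {f = ruleAt} r∈
    ... | A , refl = rhsLength≤ A

PolyBounded : (ℕ → ℕ) → Set
PolyBounded f = Σ ℕ λ B → Σ ℕ λ E → ∀ K → f K ≤ B * suc K ^ E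

poly-const : ∀ a → PolyBounded (λ _ → a)
poly-const a = a , 0 , λ K → ≤-reflexive (sym (*-identityʳ a))

poly-id : PolyBounded (λ K → K)
poly-id = 1 , 1 , λ K → ≤-trans (n≤1+n K) (≤-reflexive (sym (trans (+-identityʳ _) (*-identityʳ (suc K)))))

poly-+ : ∀ {f g} → PolyBounded f → PolyBounded g → PolyBounded (λ K → f K + g K)
poly-+ {f} {g} (B₁ , E₁ , f≤) (B₂ , E₂ , g≤) = B₁ + B₂ , E₁ + E₂ , λ K → begin
  f K + g K                                       ≤⟨ +-mono-≤ (f≤ K) (g≤ K) ⟩
  B₁ * suc K ^ E₁ + B₂ * suc K ^ E₂              ≤⟨ +-mono-≤ (*-monoʳ-≤ B₁ (^-monoʳ-≤ (suc K) (m≤m+n E₁ E₂)))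
                                                             (*-monoʳ-≤ B₂ (^-monoʳ-≤ (suc K) (m≤n+m E₂ E₁))) ⟩
  B₁ * suc K ^ (E₁ + E₂) + B₂ * suc K ^ (E₁ + E₂) ≡⟨ sym (*-distribʳ-+ (suc K ^ (E₁ + E₂)) B₁ B₂) ⟩
  (B₁ + B₂) * suc K ^ (E₁ + E₂)                   ∎
  where open ≤-Reasoning

poly-* : ∀ {f g} → PolyBounded f → PolyBounded g → PolyBounded (λ K → f K * g K)
poly-* {f} {g} (B₁ , E₁ , f≤) (B₂ , E₂ , g≤) = B₁ * B₂ , E₁ + E₂ , λ K → begin
  f K * g K                             ≤⟨ *-mono-≤ (f≤ K) (g≤ K) ⟩
  B₁ * suc K ^ E₁ * (B₂ * suc K ^ E₂)   ≡⟨ interchange B₁ B₂ (suc K ^ E₁) (suc K ^ E₂) ⟩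
  B₁ * B₂ * (suc K ^ E₁ * suc K ^ E₂)   ≡⟨ cong (B₁ * B₂ *_) (sym (^-distribˡ-+-* (suc K) E₁ E₂)) ⟩
  B₁ * B₂ * suc K ^ (E₁ + E₂)           ∎
  where
  open ≤-Reasoning
  interchange : ∀ a b x y → a * x * (b * y) ≡ a * b * (x * y)
  interchange = solve-∀

poly-^ : ∀ {f} → PolyBounded f → ∀ c → PolyBounded (λ K → f K ^ c)
poly-^ p zero    = poly-const 1
poly-^ p (suc c) = poly-* p (poly-^ p c)

suc-pred-2^ : ∀ t → suc (pred (2 ^ t)) ≡ 2 ^ t
suc-pred-2^ t = suc-pred (2 ^ t) {{m^n≢0 2 t}}

-- With m = 1 + a + 2d and t = 2m: 1 + a + t d ≤ m² ≤ 2^t.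
linear<2^ : ∀ a d → Σ ℕ λ t → a + t * d < 2 ^ t
linear<2^ a d = m + m , (begin
  suc (a + (m + m) * d)                                  ≤⟨ s≤s (m≤m+n _ _) ⟩
  suc (a + (m + m) * d + ((a + d + d) + (a + d + d) * a)) ≡⟨ sym (square a d) ⟩
  m * m                                                  ≤⟨ *-mono-≤ (<⇒≤ (n<2^n m)) (<⇒≤ (n<2^n m)) ⟩
  2 ^ m * 2 ^ m                                          ≡⟨ sym (^-distribˡ-+-* 2 m m) ⟩
  2 ^ (m + m)                                            ∎)
  where
  open ≤-Reasoning
  m : ℕ
  m = suc (a + d + d)
  square : ∀ a d → suc (a + d + d) * suc (a + d + d) ≡
           suc (a + (suc (a + d + d) + suc (a + d + d)) * d + ((a + d + d) + (a + d + d) * a))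
  square = solve-∀

-- Evaluated at K = 2^t - 1, the bound B (1 + K)^E becomes B 2^(t E) < 2^(B + t E).
poly<2^ : ∀ {f} → PolyBounded f → Σ ℕ λ K → f K < 2 ^ K
poly<2^ {f} (B , E , f≤) with linear<2^ B E
... | t , B+tE<2^t = K , (begin-strict
  f K                  ≤⟨ f≤ K ⟩
  B * suc K ^ E        ≡⟨ cong (λ z → B * z ^ E) (suc-pred-2^ t) ⟩
  B * (2 ^ t) ^ E      ≡⟨ cong (B *_) (^-*-assoc 2 t E) ⟩
  B * 2 ^ (t * E)      <⟨ *-monoˡ-< (2 ^ (t * E)) {{m^n≢0 2 (t * E)}} (n<2^n B) ⟩
  2 ^ B * 2 ^ (t * E)  ≡⟨ sym (^-distribˡ-+-* 2 B (t * E)) ⟩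
  2 ^ (B + t * E)      ≤⟨ ^-monoʳ-≤ 2 (<⇒≤pred B+tE<2^t) ⟩
  2 ^ K                ∎)
  where
  open ≤-Reasoning
  K : ℕ
  K = pred (2 ^ t)

-- Crossing sequences

write-≡ : ∀ (t t' : ℕ → Cell) p x i → t i ≡ t' i → write t p x i ≡ write t' p x i
write-≡ t t' p x i eq with i ≡ᵇ p
... | true  = refl
... | false = eq

write-≢ : ∀ (t : ℕ → Cell) p x i → i ≢ p → write t p x i ≡ t i
write-≢ t p x i i≢p with i ≡ᵇ p in eq
... | true  = ⊥-elim (i≢p (≡ᵇ⇒≡ i p (subst T (sym eq) tt)))
... | false = refl

movePos : ℕ → Move → ℕ
movePos p stay  = p
movePos p left  = pred p
movePos p right = suc p

module _ {M : Machine} where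

  state-moveHead : ∀ (c : Config M) mv → state (moveHead c mv) ≡ state c
  state-moveHead c                stay  = refl
  state-moveHead (cfg q t p →d r) left  = refl
  state-moveHead (cfg q t p ←d r) left  = refl
  state-moveHead (cfg q t p →d r) right = refl
  state-moveHead (cfg q t p ←d r) right = refl

  tape-moveHead : ∀ (c : Config M) mv → tape (moveHead c mv) ≡ tape c
  tape-moveHead c                stay  = refl
  tape-moveHead (cfg q t p →d r) left  = refl
  tape-moveHead (cfg q t p ←d r) left  = refl
  tape-moveHead (cfg q t p →d r) right = refl
  tape-moveHead (cfg q t p ←d r) right = refl

  pos-moveHead : ∀ (c : Config M) mv → pos (moveHead c mv) ≡ movePos (pos c) mv
  pos-moveHead c                stay  = refl
  pos-moveHead (cfg q t p →d r) left  = refl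
  pos-moveHead (cfg q t p ←d r) left  = refl
  pos-moveHead (cfg q t p →d r) right = refl
  pos-moveHead (cfg q t p ←d r) right = refl

-- The boundary lies between cells C' and C = 1 + C'.
module Crossing (M : Machine) (C' : ℕ) where

  C : ℕ
  C = suc C'

  State : Set
  State = Fin (2 ^ mem M)

  Transition : Set
  Transition = Maybe (State × Cell × Move)

  applyTransition : Config M → Transition → Config M
  applyTransition c nothing               = c
  applyTransition c (just (q' , x , mv)) = moveHead (cfg q' (write (tape c) (pos c) x) (pos c) (dir c) (revs c)) mv

  step≡ : ∀ c → step c ≡ applyTransition c (δ M (state c) (tape c (pos c)))
  step≡ c with δ M (state c) (tape c (pos c))
  ... | nothing = refl
  ... | just _  = refl

  -- The states in which the head re-enters the prefix [0, C) from the right.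
  reentry : ℕ → Transition → List State
  reentry p (just (q' , _ , left)) with p ≟ C
  ... | yes _ = q' ∷ []
  ... | no _  = []
  reentry p _ = []

  crossing : Config M → List State
  crossing c = reentry (pos c) (δ M (state c) (tape c (pos c)))

  crossings : ℕ → Config M → List State
  crossings zero    c = []
  crossings (suc t) c = crossing c ++ crossings t (step c)

  reentry-inside : ∀ p tr → p < C → reentry p tr ≡ []
  reentry-inside p nothing                  _   = refl
  reentry-inside p (just (q' , x , left)) p<C with p ≟ C
  ... | yes refl = ⊥-elim (<-irrefl refl p<C)
  ... | no _     = refl
  reentry-inside p (just (q' , x , right)) _ = refl
  reentry-inside p (just (q' , x , stay))  _ = refl

  -- A re-entry consumes a reversal unless the head was already moving left
  -- outside the prefix; this indicator accounts for that one exception.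
  leftOutside : ℕ → Dir → ℕ
  leftOutside p →d = 0
  leftOutside p ←d with C ≤? p
  ... | yes _ = 1
  ... | no _  = 0

  leftOutside≤1 : ∀ p d → leftOutside p d ≤ 1
  leftOutside≤1 p →d = z≤n
  leftOutside≤1 p ←d with C ≤? p
  ... | yes _ = ≤-refl
  ... | no _  = z≤n

  leftOutside-inside : ∀ p d → p < C → leftOutside p d ≡ 0
  leftOutside-inside p →d _   = refl
  leftOutside-inside p ←d p<C with C ≤? p
  ... | yes C≤p = ⊥-elim (<-irrefl refl (≤-trans p<C C≤p))
  ... | no _    = refl

  leftOutside-C : leftOutside C ←d ≡ 1
  leftOutside-C with C ≤? C
  ... | yes _   = refl
  ... | no C≰C = ⊥-elim (C≰C ≤-refl)

  leftOutside-pred : ∀ p → leftOutside (pred p) ←d ≤ leftOutside p ←d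
  leftOutside-pred p with C ≤? pred p | C ≤? p
  ... | yes _   | yes _   = ≤-refl
  ... | yes C≤p | no  C≰p = ⊥-elim (C≰p (≤-trans C≤p pred[n]≤n))
  ... | no _    | _       = z≤n

  crossing-count : ∀ c → length (crossing c) + leftOutside (pos (step c)) (dir (step c)) + revs c
                         ≤ leftOutside (pos c) (dir c) + revs (step c)
  crossing-count (cfg q t p d r) rewrite step≡ (cfg q t p d r) with δ M q (t p)
  ... | nothing                = ≤-refl
  ... | just (q' , x , stay)   = ≤-refl
  ... | just (q' , x , right)  = moveRight d
    where
    moveRight : ∀ d → let c' = moveHead (cfg q' (write t p x) p d r) right in
                leftOutside (pos c') (dir c') + r ≤ leftOutside p d + revs c'
    moveRight →d = ≤-refl
    moveRight ←d = ≤-trans (n≤1+n r) (m≤n+m (suc r) (leftOutside p ←d))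
  ... | just (q' , x , left)   = moveLeft d
    where
    moveLeft : ∀ d → let c' = moveHead (cfg q' (write t p x) p d r) left in
               length (reentry p (just (q' , x , left))) + leftOutside (pos c') (dir c') + r
               ≤ leftOutside p d + revs c'
    moveLeft →d with p ≟ C
    ... | yes refl rewrite leftOutside-inside C' ←d ≤-refl = ≤-refl
    ... | no _     = +-monoˡ-≤ r (leftOutside≤1 (pred p) ←d)
    moveLeft ←d with p ≟ C
    ... | yes refl rewrite leftOutside-inside C' ←d ≤-refl | leftOutside-C = ≤-refl
    ... | no _     = +-monoˡ-≤ r (leftOutside-pred p)

  crossings-count : ∀ t c → length (crossings t c) + leftOutside (pos (run t c)) (dir (run t c)) + revs c
                            ≤ leftOutside (pos c) (dir c) + revs (run t c)
  crossings-count zero    c = ≤-refl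
  crossings-count (suc t) c = +-cancelʳ-≤ (o₁ + r₁) _ _ (begin
    length (crossing c ++ crossings t (step c)) + o₂ + r₀ + (o₁ + r₁)
      ≡⟨ cong (λ l → l + o₂ + r₀ + (o₁ + r₁)) (length-++ (crossing c)) ⟩
    n₁ + n₂ + o₂ + r₀ + (o₁ + r₁)    ≡⟨ shuffle₁ n₁ n₂ o₁ o₂ r₀ r₁ ⟩
    (n₁ + o₁ + r₀) + (n₂ + o₂ + r₁)  ≤⟨ +-mono-≤ (crossing-count c) (crossings-count t (step c)) ⟩
    (o₀ + r₁) + (o₁ + r₂)            ≡⟨ shuffle₂ o₀ o₁ r₁ r₂ ⟩
    o₀ + r₂ + (o₁ + r₁)              ∎)
    where
    open ≤-Reasoning
    n₁ n₂ o₀ o₁ o₂ r₀ r₁ r₂ : ℕ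
    n₁ = length (crossing c)
    n₂ = length (crossings t (step c))
    o₀ = leftOutside (pos c) (dir c)
    o₁ = leftOutside (pos (step c)) (dir (step c))
    o₂ = leftOutside (pos (run t (step c))) (dir (run t (step c)))
    r₀ = revs c
    r₁ = revs (step c)
    r₂ = revs (run t (step c))
    shuffle₁ : ∀ n₁ n₂ o₁ o₂ r₀ r₁ → n₁ + n₂ + o₂ + r₀ + (o₁ + r₁) ≡ (n₁ + o₁ + r₀) + (n₂ + o₂ + r₁)
    shuffle₁ = solve-∀
    shuffle₂ : ∀ o₀ o₁ r₁ r₂ → (o₀ + r₁) + (o₁ + r₂) ≡ o₀ + r₂ + (o₁ + r₁)
    shuffle₂ = solve-∀

  crossings≤reversals : ∀ t (c : Config M) → dir c ≡ →d → length (crossings t c) ≤ revs (run t c)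
  crossings≤reversals t c refl =
    ≤-trans (m≤m+n (length (crossings t c)) _) (≤-trans (m≤m+n _ (revs c)) (crossings-count t c))

  data Head : Set where
    inside  : State → ℕ → Head
    outside : Head

  -- What can be seen of a configuration from within the prefix.
  View : Set
  View = Head × (ℕ → Cell)

  headAt : State → ℕ → Head
  headAt q p with p <? C
  ... | yes _ = inside q p
  ... | no _  = outside

  viewTransition : State → ℕ → (ℕ → Cell) → Transition → View
  viewTransition q p tp nothing               = inside q p , tp
  viewTransition q p tp (just (q' , x , mv)) = headAt q' (movePos p mv) , write tp p x

  -- Outside the prefix a view waits for the next state of a supplied
  -- crossing sequence, and re-enters at cell C'.
  viewStep : View × List State → View × List State
  viewStep ((inside q p , tp) , qs)    = viewTransition q p tp (δ M q (tp p)) , qs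
  viewStep ((outside , tp) , [])       = (outside , tp) , []
  viewStep ((outside , tp) , q ∷ qs)   = (inside q C' , tp) , qs

  viewRun : ℕ → View × List State → View × List State
  viewRun zero    vqs = vqs
  viewRun (suc f) vqs = viewRun f (viewStep vqs)

  viewRun-+ : ∀ f g vqs → viewRun (f + g) vqs ≡ viewRun g (viewRun f vqs)
  viewRun-+ zero    g vqs = refl
  viewRun-+ (suc f) g vqs = viewRun-+ f g (viewStep vqs)

  viewRun-fixed : ∀ f vqs → viewStep vqs ≡ vqs → viewRun f vqs ≡ vqs
  viewRun-fixed zero    vqs fixed = refl
  viewRun-fixed (suc f) vqs fixed = trans (cong (viewRun f) fixed) (viewRun-fixed f vqs fixed)

  Agree : (ℕ → Cell) → (ℕ → Cell) → Set
  Agree t t' = ∀ i → i < C → t i ≡ t' i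

  Tracks : Config M → View → Set
  Tracks c (inside q p , tp) = state c ≡ q × pos c ≡ p × p < C × Agree (tape c) tp
  Tracks c (outside , tp)    = C ≤ pos c × Agree (tape c) tp

  tracks⇒agree : ∀ c v → Tracks c v → Agree (tape c) (proj₂ v)
  tracks⇒agree c (inside q p , tp) (_ , _ , _ , agree) = agree
  tracks⇒agree c (outside , tp)    (_ , agree)         = agree

  tracks-headAt : ∀ c q p tp → state c ≡ q → pos c ≡ p → Agree (tape c) tp → Tracks c (headAt q p , tp)
  tracks-headAt c q p tp q≡ p≡ agree with p <? C
  ... | yes p<C = q≡ , p≡ , p<C , agree
  ... | no  p≮C = subst (C ≤_) (sym p≡) (≮⇒≥ p≮C) , agree

  SimulatedStep : Config M → View → List State → Set
  SimulatedStep c v qs =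
    Σ ℕ λ f → Σ View λ v' → viewRun f (v , crossing c ++ qs) ≡ (v' , qs) × Tracks (step c) v'

  simulate-inside : ∀ c tp qs → pos c < C → Agree (tape c) tp →
                    SimulatedStep c (inside (state c) (pos c) , tp) qs
  simulate-inside c tp qs p<C agree = go _ refl
    where
    tracks : ∀ tr → Tracks (applyTransition c tr) (viewTransition (state c) (pos c) tp tr)
    tracks nothing              = refl , refl , p<C , agree
    tracks (just (q' , x , mv)) = tracks-headAt _ q' _ _ (state-moveHead _ mv) (pos-moveHead _ mv)
      λ i i<C → trans (cong (λ t → t i) (tape-moveHead _ mv)) (write-≡ (tape c) tp (pos c) x i (agree i i<C))
    go : ∀ tr → δ M (state c) (tape c (pos c)) ≡ tr → SimulatedStep c (inside (state c) (pos c) , tp) qs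
    go tr eq rewrite step≡ c | eq | reentry-inside (pos c) tr p<C =
      1 , viewTransition (state c) (pos c) tp tr ,
      cong (λ tr → viewTransition (state c) (pos c) tp tr , qs) (trans (cong (δ M (state c)) (sym (agree (pos c) p<C))) eq) ,
      tracks tr

  simulate-outside : ∀ c tp qs → C ≤ pos c → Agree (tape c) tp → SimulatedStep c (outside , tp) qs
  simulate-outside c tp qs C≤p agree = go _ refl
    where
    go : ∀ tr → δ M (state c) (tape c (pos c)) ≡ tr → SimulatedStep c (outside , tp) qs
    go nothing              eq rewrite step≡ c | eq = 0 , (outside , tp) , refl , C≤p , agree
    go (just (q' , x , mv)) eq rewrite step≡ c | eq = move mv
      where
      c' : Config M
      c' = cfg q' (write (tape c) (pos c) x) (pos c) (dir c) (revs c)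
      agree' : ∀ mv → Agree (tape (moveHead c' mv)) tp
      agree' mv i i<C = trans (cong (λ t → t i) (tape-moveHead c' mv))
        (trans (write-≢ (tape c) (pos c) x i (λ i≡p → <-irrefl i≡p (≤-trans i<C C≤p))) (agree i i<C))
      move : ∀ mv → Σ ℕ λ f → Σ View λ v' →
             viewRun f ((outside , tp) , reentry (pos c) (just (q' , x , mv)) ++ qs) ≡ (v' , qs) ×
             Tracks (moveHead c' mv) v'
      move stay  = 0 , (outside , tp) , refl , subst (C ≤_) (sym (pos-moveHead c' stay)) C≤p , agree' stay
      move right = 0 , (outside , tp) , refl ,
                   subst (C ≤_) (sym (pos-moveHead c' right)) (≤-trans C≤p (n≤1+n _)) , agree' right
      move left with pos c ≟ C
      ... | yes p≡C = 1 , (inside q' C' , tp) , refl , state-moveHead c' left ,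
                      trans (pos-moveHead c' left) (cong pred p≡C) , ≤-refl , agree' left
      ... | no  p≢C = 0 , (outside , tp) , refl ,
                      subst (C ≤_) (sym (pos-moveHead c' left)) (<⇒≤pred (≤∧≢⇒< C≤p (p≢C ∘ sym))) , agree' left

  simulate-step : ∀ c v qs → Tracks c v → SimulatedStep c v qs
  simulate-step c (inside q p , tp) qs (refl , refl , p<C , agree) = simulate-inside c tp qs p<C agree
  simulate-step c (outside , tp)    qs (C≤p , agree)              = simulate-outside c tp qs C≤p agree

  simulate : ∀ t c v qs → Tracks c v →
             Σ ℕ λ f → Σ View λ v' → viewRun f (v , crossings t c ++ qs) ≡ (v' , qs) × Tracks (run t c) v'
  simulate zero    c v qs tracks = 0 , v , refl , tracks
  simulate (suc t) c v qs tracks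
    with f₁ , v₁ , run₁ , tracks₁ ← simulate-step c v (crossings t (step c) ++ qs) tracks
    with f₂ , v₂ , run₂ , tracks₂ ← simulate t (step c) v₁ qs tracks₁
    = f₁ + f₂ , v₂ , (begin
        viewRun (f₁ + f₂) (v , (crossing c ++ crossings t (step c)) ++ qs)
          ≡⟨ cong (λ l → viewRun (f₁ + f₂) (v , l)) (++-assoc (crossing c) (crossings t (step c)) qs) ⟩
        viewRun (f₁ + f₂) (v , crossing c ++ crossings t (step c) ++ qs)
          ≡⟨ viewRun-+ f₁ f₂ _ ⟩
        viewRun f₂ (viewRun f₁ (v , crossing c ++ crossings t (step c) ++ qs))
          ≡⟨ cong (viewRun f₂) run₁ ⟩
        viewRun f₂ (v₁ , crossings t (step c) ++ qs)
          ≡⟨ run₂ ⟩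
        (v₂ , qs) ∎) , tracks₂
    where open ≡-Reasoning

  halted⇒viewStep-fixed : ∀ c v → Halted c → Tracks c v → viewStep (v , []) ≡ (v , [])
  halted⇒viewStep-fixed c (inside q p , tp) halted (refl , refl , p<C , agree)
    rewrite sym (agree (pos c) p<C) | halted = refl
  halted⇒viewStep-fixed c (outside , tp) halted _ = refl

  -- Both runs end in the view obtained by feeding the common crossing sequence
  -- to the common initial view, and a halted view no longer changes.
  same-crossings⇒same-prefix : ∀ c₁ c₂ v t₁ t₂ → Tracks c₁ v → Tracks c₂ v →
    Halted (run t₁ c₁) → Halted (run t₂ c₂) → crossings t₁ c₁ ≡ crossings t₂ c₂ →
    Agree (tape (run t₁ c₁)) (tape (run t₂ c₂))
  same-crossings⇒same-prefix c₁ c₂ v t₁ t₂ tracks₁ tracks₂ halted₁ halted₂ same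
    with f₁ , v₁ , run₁ , end₁ ← simulate t₁ c₁ v [] tracks₁
    with f₂ , v₂ , run₂ , end₂ ← simulate t₂ c₂ v [] tracks₂
    = λ i i<C → trans (tracks⇒agree _ v₁ end₁ i i<C)
                  (trans (cong (λ v → proj₂ v i) v₁≡v₂) (sym (tracks⇒agree _ v₂ end₂ i i<C)))
    where
    start : View × List State
    start = v , crossings t₁ c₁ ++ []
    after₁ : viewRun (f₁ + f₂) start ≡ (v₁ , [])
    after₁ = trans (viewRun-+ f₁ f₂ _)
               (trans (cong (viewRun f₂) run₁) (viewRun-fixed f₂ _ (halted⇒viewStep-fixed _ v₁ halted₁ end₁)))
    after₂ : viewRun (f₂ + f₁) start ≡ (v₂ , [])
    after₂ = trans (cong (λ l → viewRun (f₂ + f₁) (v , l ++ [])) same)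
               (trans (viewRun-+ f₂ f₁ _)
                 (trans (cong (viewRun f₁) run₂) (viewRun-fixed f₁ _ (halted⇒viewStep-fixed _ v₂ halted₂ end₂))))
    v₁≡v₂ : v₁ ≡ v₂
    v₁≡v₂ = cong proj₁ (trans (sym after₁) (trans (cong (λ f → viewRun f start) (+-comm f₁ f₂)) after₂))

-- The fooling argument

listTape-++ : ∀ (x y : List Bool) j → j < length x → listTape (x ++ y) j ≡ listTape x j
listTape-++ (b ∷ x) y zero    _         = refl
listTape-++ (b ∷ x) y (suc j) (s≤s j<x) = listTape-++ x y j j<x

Output-unique : ∀ (t : ℕ → Cell) w₁ w₂ → Output t w₁ → Output t w₂ → w₁ ≡ w₂
Output-unique t []        []        _              _              = refl
Output-unique t []        (b ∷ w₂)  (_ , end)      (cells , _)    with () ← trans (sym end) (cells zero)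
Output-unique t (b ∷ w₁)  []        (cells , _)    (_ , end)      with () ← trans (sym end) (cells zero)
Output-unique t (b ∷ w₁)  (b' ∷ w₂) (cells₁ , end₁) (cells₂ , end₂) with trans (sym (cells₁ zero)) (cells₂ zero)
... | refl = cong (b ∷_) (Output-unique (λ i → t (suc i)) w₁ w₂ ((λ i → cells₁ (suc i)) , end₁) ((λ i → cells₂ (suc i)) , end₂))

Output-transfer : ∀ C (t t' : ℕ → Cell) w → (∀ i → i < C → t i ≡ t' i) → length w < C → Output t' w → Output t w
Output-transfer C t t' w agree w<C (cells , end) =
  (λ i → trans (agree (toℕ i) (<-trans (toℕ<n i) w<C)) (cells i)) , trans (agree (length w) w<C) end

-- Bijective base-(1 + n) numerals.
module ListCode (n : ℕ) where

  base : ℕ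
  base = suc n

  code : List (Fin n) → ℕ
  code []      = 0
  code (q ∷ l) = suc (toℕ q) + code l * base

  code< : ∀ l → code l < base ^ length l
  code< []      = s≤s z≤n
  code< (q ∷ l) = begin-strict
    suc (toℕ q) + code l * base  <⟨ +-monoˡ-< (code l * base) (s≤s (toℕ<n q)) ⟩
    suc (code l) * base          ≤⟨ *-monoˡ-≤ base (code< l) ⟩
    base ^ length l * base       ≡⟨ *-comm (base ^ length l) base ⟩
    base ^ length (q ∷ l)        ∎
    where open ≤-Reasoning

  code-injective : ∀ l l' → code l ≡ code l' → l ≡ l'
  code-injective []      []        _  = refl
  code-injective (q ∷ l) (q' ∷ l') eq = cong₂ _∷_ (toℕ-injective (suc-injective digit≡)) (code-injective l l' rest≡)
    where
    lastDigit : ∀ (r : Fin n) x → (suc (toℕ r) + x * base) % base ≡ suc (toℕ r)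
    lastDigit r x = trans ([m+kn]%n≡m%n (suc (toℕ r)) x base) (m<n⇒m%n≡m (s≤s (toℕ<n r)))
    digit≡ : suc (toℕ q) ≡ suc (toℕ q')
    digit≡ = trans (sym (lastDigit q (code l))) (trans (cong (_% base) eq) (lastDigit q' (code l')))
    rest≡ : code l ≡ code l'
    rest≡ = *-cancelʳ-≡ (code l) (code l') base
              (+-cancelˡ-≡ (suc (toℕ q)) _ _ (trans eq (cong (λ d → d + code l' * base) (sym digit≡))))

Solves : ℕ → (ℕ → Machine) → Set
Solves c M = ∀ n → (mem (M n) ≤ polylog c n) ×
                   (∀ (s : List Bool) → length s ≡ n → SolvesApprox c (M n) (polylog c n) s)

module Bounds (c : ℕ) where

  passBound : ℕ → ℕ
  passBound K = c * (2 + K) ^ c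

  suffixLength : ℕ → ℕ
  suffixLength K = suc (suc (passBound K) * passBound K)

  -- ℓ < 2^K keeps ⌊log₂ n⌋ ≤ K + 1, and the second summand bounds |APPROX|.
  budget : ℕ → ℕ
  budget K = suffixLength K + doublingSizeBound K (suffixLength K) ^ c

  passBound-poly : PolyBounded passBound
  passBound-poly = poly-* (poly-const c) (poly-^ (poly-+ (poly-const 2) poly-id) c)

  suffixLength-poly : PolyBounded suffixLength
  suffixLength-poly = poly-+ (poly-const 1) (poly-* (poly-+ (poly-const 1) passBound-poly) passBound-poly)

  budget-poly : PolyBounded budget
  budget-poly = poly-+ suffixLength-poly (poly-^ doublingSize c)
    where
    doublingSize : PolyBounded (λ K → doublingSizeBound K (suffixLength K))
    doublingSize = poly-+ (poly-+ (poly-const 5) poly-id)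
                     (poly-+ (poly-const 1) (poly-* (poly-+ (poly-const 2) poly-id)
                       (poly-* (poly-+ (poly-const 4) suffixLength-poly) (poly-+ (poly-const 5) poly-id))))

module Fooling (c : ℕ) (Ms : ℕ → Machine) (solves : Solves c Ms) (K : ℕ)
               (budget<2^K : Bounds.budget c K < 2 ^ K) where
  open Bounds c

  Q ℓ n : ℕ
  Q = passBound K
  ℓ = suffixLength K
  n = 2 ^ K + ℓ

  M : Machine
  M = Ms n

  open Crossing M (pred (2 ^ K))
  open ListCode (2 ^ mem M)

  C≡2^K : C ≡ 2 ^ K
  C≡2^K = suc-pred-2^ K

  ℓ<2^K : ℓ < 2 ^ K
  ℓ<2^K = ≤-<-trans (m≤m+n ℓ _) budget<2^K

  polylog≤Q : polylog c n ≤ Q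
  polylog≤Q = *-monoʳ-≤ c (^-monoˡ-≤ c (≤-trans (+-monoˡ-≤ 1 log≤) (≤-reflexive (+-comm (suc K) 1))))
    where
    log≤ : ⌊log₂ n ⌋ ≤ suc K
    log≤ = ≤-trans (⌊log₂⌋-mono-≤ {n = 2 ^ suc K} (+-monoʳ-≤ (2 ^ K) (≤-trans (<⇒≤ ℓ<2^K) (m≤m+n (2 ^ K) 0))))
                   (≤-reflexive (⌊log₂[2^n]⌋≡n (suc K)))

  suffix : Fin (2 ^ ℓ) → List Bool
  suffix i = toBits ℓ (toℕ i)

  input : Fin (2 ^ ℓ) → List Bool
  input i = DoublingGrammar.word K (suffix i)

  length-input : ∀ i → length (input i) ≡ n
  length-input i = trans (length-++ (replicate (2 ^ K) false))
                         (cong₂ _+_ (length-replicate (2 ^ K)) (length-toBits ℓ (toℕ i)))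

  solution : ∀ i → SolvesApprox c M (polylog c n) (input i)
  solution i = proj₂ (solves n) (input i) (length-input i)

  steps : Fin (2 ^ ℓ) → ℕ
  steps i = proj₁ (solution i)

  start : Fin (2 ^ ℓ) → Config M
  start i = initConfig M (input i)

  final : Fin (2 ^ ℓ) → Config M
  final i = run (steps i) (start i)

  halted : ∀ i → Halted (final i)
  halted i = proj₁ (proj₂ (solution i))

  passes≤ : ∀ i → passes (final i) ≤ polylog c n
  passes≤ i = proj₁ (proj₂ (proj₂ (solution i)))

  approx : Fin (2 ^ ℓ) → Grammar
  approx i = proj₁ (proj₂ (proj₂ (proj₂ (solution i))))

  output : ∀ i → Output (tape (final i)) (encode (approx i))
  output i = proj₁ (proj₂ (proj₂ (proj₂ (proj₂ (solution i)))))

  generates : ∀ i → GeneratesExactly (approx i) (input i)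
  generates i = proj₁ (proj₂ (proj₂ (proj₂ (proj₂ (proj₂ (solution i))))))

  approximates : ∀ i G → GeneratesExactly G (input i) → size (approx i) ≤ size G ^ c
  approximates i = proj₂ (proj₂ (proj₂ (proj₂ (proj₂ (proj₂ (solution i))))))

  -- The doubling grammar witnesses |OPT| ≤ doublingSizeBound K ℓ.
  approx-fits : ∀ i → length (encode (approx i)) < C
  approx-fits i = subst (size (approx i) <_) (sym C≡2^K) (begin-strict
    size (approx i)                       ≤⟨ approximates i (DoublingGrammar.grammar K (suffix i)) (DoublingGrammar.generates K (suffix i)) ⟩
    size (DoublingGrammar.grammar K (suffix i)) ^ c
      ≤⟨ ^-monoˡ-≤ c (DoublingGrammar.size-grammar≤ K (suffix i)) ⟩
    doublingSizeBound K (length (suffix i)) ^ c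
      ≡⟨ cong (λ l → doublingSizeBound K l ^ c) (length-toBits ℓ (toℕ i)) ⟩
    doublingSizeBound K ℓ ^ c             <⟨ ≤-<-trans (m≤n+m _ ℓ) budget<2^K ⟩
    2 ^ K                                 ∎)
    where open ≤-Reasoning

  initialView : View
  initialView = inside (init M) 0 , listTape (replicate (2 ^ K) false)

  tracks-start : ∀ i → Tracks (start i) initialView
  tracks-start i = refl , refl , s≤s z≤n , λ j j<C →
    listTape-++ (replicate (2 ^ K) false) (suffix i) j
      (subst (j <_) (trans C≡2^K (sym (length-replicate (2 ^ K)))) j<C)

  crossingsOf : Fin (2 ^ ℓ) → List State
  crossingsOf i = crossings (steps i) (start i)

  length-crossingsOf≤Q : ∀ i → length (crossingsOf i) ≤ Q
  length-crossingsOf≤Q i =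
    ≤-trans (crossings≤reversals (steps i) (start i) refl) (≤-trans (n≤1+n _) (≤-trans (passes≤ i) polylog≤Q))

  E : ℕ
  E = suc Q * Q

  code<2^E : ∀ i → code (crossingsOf i) < 2 ^ E
  code<2^E i = begin-strict
    code (crossingsOf i)                 <⟨ code< (crossingsOf i) ⟩
    base ^ length (crossingsOf i)        ≤⟨ ^-monoʳ-≤ base (length-crossingsOf≤Q i) ⟩
    base ^ Q                             ≤⟨ ^-monoˡ-≤ Q base≤ ⟩
    (2 ^ suc Q) ^ Q                      ≡⟨ ^-*-assoc 2 (suc Q) Q ⟩
    2 ^ E                                ∎
    where
    open ≤-Reasoning
    mem≤Q : mem M ≤ Q
    mem≤Q = ≤-trans (proj₁ (solves n)) polylog≤Q
    base≤ : base ≤ 2 ^ suc Q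
    base≤ = begin
      suc (2 ^ mem M)      ≤⟨ s≤s (^-monoʳ-≤ 2 mem≤Q) ⟩
      1 + 2 ^ Q            ≤⟨ +-monoˡ-≤ (2 ^ Q) (m^n>0 2 Q) ⟩
      2 ^ Q + 2 ^ Q        ≡⟨ cong (2 ^ Q +_) (sym (+-identityʳ (2 ^ Q))) ⟩
      2 ^ suc Q            ∎

  fingerprint : Fin (2 ^ ℓ) → Fin (2 ^ E)
  fingerprint i = fromℕ< (code<2^E i)

  fingerprint-injective : ∀ i j → fingerprint i ≡ fingerprint j → toℕ i ≡ toℕ j
  fingerprint-injective i j same = toBits-injective ℓ (toℕ<n i) (toℕ<n j) (++-cancelˡ (replicate (2 ^ K) false) (suffix i) (suffix j) input≡)
    where
    crossings≡ : crossingsOf i ≡ crossingsOf j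
    crossings≡ = code-injective (crossingsOf i) (crossingsOf j) (trans (sym (toℕ-fromℕ< (code<2^E i)))
                                      (trans (cong toℕ same) (toℕ-fromℕ< (code<2^E j))))
    prefix≡ : Agree (tape (final i)) (tape (final j))
    prefix≡ = same-crossings⇒same-prefix (start i) (start j) initialView (steps i) (steps j)
                (tracks-start i) (tracks-start j) (halted i) (halted j) crossings≡
    encode≡′ : encode (approx i) ≡ encode (approx j)
    encode≡′ = Output-unique (tape (final i)) (encode (approx i)) (encode (approx j)) (output i)
                 (Output-transfer C (tape (final i)) (tape (final j)) (encode (approx j)) prefix≡ (approx-fits j) (output j))
    input≡ : input i ≡ input j
    input≡ = same-encoding⇒same-word (approx i) (approx j) encode≡′ (generates i) (generates j)

  2^E<2^ℓ : 2 ^ E < 2 ^ ℓ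
  2^E<2^ℓ = ^-monoʳ-< 2 (s≤s (s≤s z≤n)) (n<1+n E)

  absurd : ⊥
  absurd with i , j , i<j , same ← pigeonhole 2^E<2^ℓ fingerprint
    = <-irrefl (fingerprint-injective i j same) i<j

theorem4 : ¬ (Σ ℕ λ c → Σ (ℕ → Machine) λ M →
               ∀ n → (mem (M n) ≤ polylog c n) ×
                     (∀ (s : List Bool) → length s ≡ n → SolvesApprox c (M n) (polylog c n) s))
theorem4 (c , M , solves) = fooled (poly<2^ (Bounds.budget-poly c))
  where
  fooled : (Σ ℕ λ K → Bounds.budget c K < 2 ^ K) → ⊥
  fooled (K , budget<2^K) = Fooling.absurd c M solves K budget<2^K
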